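{- Let $k \geq 3$ and let $G$ be the graph on $n = k+1$ vertices obtained from the cycle $C_k$ by adding one new vertex $u$ and one edge joining $u$ to a vertex of the cycle. Then $\gamma_{gr}^L(G) = n$.
   Context: For a vertex $v$, $N(v)$ is its open neighborhood (the set of its neighbors) and $N[v] = N(v) \cup \{v\}$ its closed neighborhood. An L-sequence of a graph $G$ is a sequence $(v_1, \ldots, v_k)$ of distinct vertices of $G$ such that for every $i \in \{1,\ldots,k\}$, $N[v_i] \setminus \bigcup_{j=1}^{i-1} N(v_j) \neq \emptyset$. The L-Grundy domination number $\gamma_{gr}^L(G)$ is the maximum length of an L-sequence of $G$. -}

module Defs where

open import Data.Nat using (ℕ; zero; suc; _+_; _<_; _≤_; _∸_)
open import Data.Fin using (Fin; toℕ)
open import Data.List using (List; []; _∷_; length)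
open import Data.List.Relation.Unary.Unique.Propositional using (Unique)
open import Data.Product using (∃; _×_; _,_)
open import Data.Sum using (_⊎_)
open import Data.Unit using (⊤)
open import Relation.Nullary using (¬_)
open import Relation.Binary.PropositionalEquality using (_≡_)

module LGrundy {n : ℕ} (Adj : Fin n → Fin n → Set) where

  InOpenNbhd : Fin n → Fin n → Set
  InOpenNbhd w v = Adj v w

  InClosedNbhd : Fin n → Fin n → Set
  InClosedNbhd w v = (w ≡ v) ⊎ Adj v w

  NotInUnionOpen : Fin n → List (Fin n) → Set
  NotInUnionOpen w [] = ⊤
  NotInUnionOpen w (u ∷ us) = ¬ InOpenNbhd w u × NotInUnionOpen w us

  -- For a list given in REVERSE order (latest vertex first), every vertex v
  -- satisfies N[v] \ ⋃_{earlier u} N(u) ≠ ∅.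
  Footprinted : List (Fin n) → Set
  Footprinted [] = ⊤
  Footprinted (v ∷ earlier) =
    (∃ λ w → InClosedNbhd w v × NotInUnionOpen w earlier) × Footprinted earlier

  -- An L-sequence (v₁,…,v_k) is represented by the reversed list
  -- v_k ∷ … ∷ v₁ ∷ [] : distinct vertices, each with the footprint property.
  IsLSeqRev : List (Fin n) → Set
  IsLSeqRev vs = Unique vs × Footprinted vs

  LGrundyDominationNumberIs : ℕ → Set
  LGrundyDominationNumberIs m =
    (∃ λ vs → IsLSeqRev vs × length vs ≡ m) ×
    (∀ vs → IsLSeqRev vs → length vs ≤ m)

open LGrundy public

-- Directed edge list of C_k with a pendant vertex, on vertex set Fin (suc k):
-- cycle vertices 0,…,k-1 with edges {i,i+1} (i+1 < k) and {k-1,0};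
-- the new vertex u = k is joined to cycle vertex 0.
data CycleEdge (k : ℕ) : Fin (suc k) → Fin (suc k) → Set where
  step    : ∀ {a b} → suc (toℕ a) ≡ toℕ b → toℕ b < k → CycleEdge k a b
  wrap    : ∀ {a b} → toℕ a ≡ k ∸ 1 → toℕ b ≡ 0 → CycleEdge k a b
  pendant : ∀ {a b} → toℕ a ≡ k → toℕ b ≡ 0 → CycleEdge k a b

CyclePendantAdj : (k : ℕ) → Fin (suc k) → Fin (suc k) → Set
CyclePendantAdj k a b = CycleEdge k a b ⊎ CycleEdge k b a

{-# OPTIONS --safe #-}
module Submission where

-- Number the cycle 0, 1, …, k−1 and let u be joined to 0. Then
-- u, 1, 2, …, k−3, k−1, k−2, 0 is an L-sequence through all n vertices: u and k−1
-- footprint themselves, each i ≤ k−3 footprints i+1, k−2 footprints k−1 once more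
-- (its neighbours k−2 and 0 have not been played), and 0 footprints u, whose only
-- neighbour is 0. Conversely the terms of an L-sequence are distinct, so there are
-- at most n of them.

open import Defs
open import Data.Nat using (ℕ; zero; suc; _≤_; _<_; _∸_; z≤n; s≤s)
open import Data.Nat.Properties
  using ( ≤-refl; ≤-trans; <⇒≤; <⇒≱; 1+n≢n; n>0⇒n≢0; n≮n; m≤n⇒m≤1+n; n≤1+n
        ; m≤n+m; m<n+m; ≰⇒>; _≤?_; suc-injective)
open import Data.Fin using (Fin; toℕ; fromℕ<)
import Data.Fin as Fin
open import Data.Fin.Properties using (toℕ-fromℕ<; pigeonhole)
open import Data.List using (List; []; _∷_; length; lookup)
open import Data.List.Membership.Propositional.Properties using (∈-lookup)
open import Data.List.Relation.Unary.All as All using (All; []; _∷_)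
open import Data.List.Relation.Unary.AllPairs using ([]; _∷_)
open import Data.List.Relation.Unary.Unique.Propositional using (Unique)
open import Data.Product using (_×_; _,_; proj₁)
open import Data.Sum using (_⊎_; inj₁; inj₂; [_,_])
open import Data.Unit using (tt)
open import Data.Empty using (⊥-elim)
open import Function using (_∘_)
open import Relation.Nullary using (¬_; yes; no)
open import Relation.Binary.PropositionalEquality
  using (_≡_; _≢_; refl; sym; trans; cong; subst)

Unique⇒lookup-≢ : ∀ {A : Set} {xs : List A} → Unique xs →
                  ∀ {i j} → i Fin.< j → lookup xs i ≢ lookup xs j
Unique⇒lookup-≢ (x∉xs ∷ _) {Fin.zero} {Fin.suc j} _ = All.lookup x∉xs (∈-lookup j)
Unique⇒lookup-≢ (_ ∷ xs!) {Fin.suc i} {Fin.suc j} (s≤s i<j) = Unique⇒lookup-≢ xs! i<j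

Unique⇒length≤ : ∀ {n} {xs : List (Fin n)} → Unique xs → length xs ≤ n
Unique⇒length≤ {n} {xs} xs! with length xs ≤? n
... | yes ≤n = ≤n
... | no ≰n with i , j , i<j , eq ← pigeonhole (≰⇒> ≰n) (lookup xs) =
  ⊥-elim (Unique⇒lookup-≢ xs! i<j eq)

module _ {n : ℕ} (Adj : Fin n → Fin n → Set) where

  All¬Adj⇒NotInUnionOpen : ∀ {w vs} → All (λ x → ¬ Adj x w) vs → NotInUnionOpen Adj w vs
  All¬Adj⇒NotInUnionOpen []          = tt
  All¬Adj⇒NotInUnionOpen (¬xw ∷ ¬vw) = ¬xw , All¬Adj⇒NotInUnionOpen ¬vw

  IsLSeqRev-∷ : ∀ {v vs} w → InClosedNbhd Adj w v → All (λ x → ¬ Adj x w) vs →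
                All (v ≢_) vs → IsLSeqRev Adj vs → IsLSeqRev Adj (v ∷ vs)
  IsLSeqRev-∷ w w∈N[v] ¬adj v∉vs (vs! , vs-fp) =
    (v∉vs ∷ vs!) , (w , w∈N[v] , All¬Adj⇒NotInUnionOpen ¬adj) , vs-fp

All-≢-of-¬ : ∀ {A : Set} {P : A → Set} {v} {vs} → ¬ P v → All P vs → All (v ≢_) vs
All-≢-of-¬ {P = P} ¬Pv = All.map λ Px v≡x → ¬Pv (subst P (sym v≡x) Px)

[k∸1]+1≮k : ∀ {k c} → c ≡ k ∸ 1 → ¬ (suc c < k)
[k∸1]+1≮k {suc k} refl = n≮n (suc k)

k≢k∸1 : ∀ {k} → 0 < k → k ≢ k ∸ 1
k≢k∸1 {suc k} _ = 1+n≢n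

k+1≮k : ∀ {k} → ¬ (suc k < k)
k+1≮k {k} k+1<k = <⇒≱ k+1<k (n≤1+n k)

module _ {k c : ℕ} {x w : Fin (suc k)} where

  inner-neighbours : toℕ w ≡ c → 0 < c → suc c < k → CyclePendantAdj k x w →
                     suc (toℕ x) ≡ c ⊎ toℕ x ≡ suc c
  inner-neighbours refl _   _ (inj₁ (step x+1≡w _))  = inj₁ x+1≡w
  inner-neighbours refl 0<w _ (inj₁ (wrap _ w≡0))    = ⊥-elim (n>0⇒n≢0 0<w w≡0)
  inner-neighbours refl 0<w _ (inj₁ (pendant _ w≡0)) = ⊥-elim (n>0⇒n≢0 0<w w≡0)
  inner-neighbours refl _   _ (inj₂ (step w+1≡x _))  = inj₂ (sym w+1≡x)
  inner-neighbours refl _ w+1<k (inj₂ (wrap w≡k∸1 _))  = ⊥-elim ([k∸1]+1≮k w≡k∸1 w+1<k)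
  inner-neighbours refl _ w+1<k (inj₂ (pendant w≡k _)) =
    ⊥-elim (k+1≮k (subst (λ c → suc c < k) w≡k w+1<k))

  last-neighbours : toℕ w ≡ c → 0 < c → suc c ≡ k → CyclePendantAdj k x w →
                    suc (toℕ x) ≡ c ⊎ toℕ x ≡ 0
  last-neighbours refl _   _ (inj₁ (step x+1≡w _))  = inj₁ x+1≡w
  last-neighbours refl 0<w _ (inj₁ (wrap _ w≡0))    = ⊥-elim (n>0⇒n≢0 0<w w≡0)
  last-neighbours refl 0<w _ (inj₁ (pendant _ w≡0)) = ⊥-elim (n>0⇒n≢0 0<w w≡0)
  last-neighbours refl _ w+1≡k (inj₂ (step w+1≡x x<k)) =
    ⊥-elim (n≮n k (subst (_< k) (trans (sym w+1≡x) w+1≡k) x<k))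
  last-neighbours refl _ _     (inj₂ (wrap _ x≡0))    = inj₂ x≡0
  last-neighbours refl _ w+1≡k (inj₂ (pendant w≡k _)) = ⊥-elim (1+n≢n (trans w+1≡k (sym w≡k)))

module _ {k : ℕ} {x w : Fin (suc k)} where

  pendant-neighbour : toℕ w ≡ k → 0 < k → CyclePendantAdj k x w → toℕ x ≡ 0
  pendant-neighbour w≡k _   (inj₁ (step _ w<k))    = ⊥-elim (n≮n k (subst (_< k) w≡k w<k))
  pendant-neighbour w≡k 0<k (inj₁ (wrap _ w≡0))    = ⊥-elim (n>0⇒n≢0 0<k (trans (sym w≡k) w≡0))
  pendant-neighbour w≡k 0<k (inj₁ (pendant _ w≡0)) = ⊥-elim (n>0⇒n≢0 0<k (trans (sym w≡k) w≡0))
  pendant-neighbour w≡k _   (inj₂ (step w+1≡x x<k)) =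
    ⊥-elim (k+1≮k (subst (_< k) (trans (sym w+1≡x) (cong suc w≡k)) x<k))
  pendant-neighbour w≡k 0<k (inj₂ (wrap w≡k∸1 _))  = ⊥-elim (k≢k∸1 0<k (trans (sym w≡k) w≡k∸1))
  pendant-neighbour _   _   (inj₂ (pendant _ x≡0)) = x≡0

module CyclePendantLSeq (m : ℕ) where

  k : ℕ
  k = suc (suc (suc m))

  G : Fin (suc k) → Fin (suc k) → Set
  G = CyclePendantAdj k

  vertex : (i : ℕ) → .(i ≤ k) → Fin (suc k)
  vertex i i≤k = fromℕ< (s≤s i≤k)

  toℕ-vertex : ∀ i .(i≤k : i ≤ k) → toℕ (vertex i i≤k) ≡ i
  toℕ-vertex i i≤k = toℕ-fromℕ< (s≤s i≤k)

  u : Fin (suc k)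
  u = vertex k ≤-refl

  cycle-edge : ∀ i .(i≤k : i ≤ k) .(i+1≤k : suc i ≤ k) → suc i < k →
               G (vertex i i≤k) (vertex (suc i) i+1≤k)
  cycle-edge i i≤k i+1≤k i+1<k = inj₁ (step
    (trans (cong suc (toℕ-vertex i i≤k)) (sym (toℕ-vertex (suc i) i+1≤k)))
    (subst (_< k) (sym (toℕ-vertex (suc i) i+1≤k)) i+1<k))

  pendant-edge : G (vertex 0 z≤n) u
  pendant-edge = inj₂ (pendant (toℕ-vertex k ≤-refl) (toℕ-vertex 0 z≤n))

  ≤m⇒≤k : ∀ {i} → i ≤ m → i ≤ k
  ≤m⇒≤k i≤m = ≤-trans i≤m (m≤n+m m 3)

  ascent : (j : ℕ) → .(j ≤ m) → List (Fin (suc k))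
  ascent zero    _     = u ∷ []
  ascent (suc j) j+1≤m = vertex (suc j) (≤m⇒≤k j+1≤m) ∷ ascent j (<⇒≤ j+1≤m)

  ascent-length : ∀ j .(j≤m : j ≤ m) → length (ascent j j≤m) ≡ suc j
  ascent-length zero    _     = refl
  ascent-length (suc j) j+1≤m = cong suc (ascent-length j (<⇒≤ j+1≤m))

  data Ascended (j : ℕ) : ℕ → Set where
    cycle-vertex   : ∀ {x} → 0 < x → x ≤ j → Ascended j x
    pendant-vertex : Ascended j k

  Ascended-positive : ∀ {j x} → Ascended j x → 0 < x
  Ascended-positive (cycle-vertex 0<x _) = 0<x
  Ascended-positive pendant-vertex       = s≤s z≤n

  Ascended-suc : ∀ {j x} → Ascended j x → Ascended (suc j) x
  Ascended-suc (cycle-vertex 0<x x≤j) = cycle-vertex 0<x (m≤n⇒m≤1+n x≤j)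
  Ascended-suc pendant-vertex         = pendant-vertex

  Ascended-avoids : ∀ {j x c} → Ascended j x → j < c → c < k → x ≢ c
  Ascended-avoids (cycle-vertex _ x≤j) j<c _ refl = <⇒≱ j<c x≤j
  Ascended-avoids pendant-vertex       _ c<k refl = n≮n k c<k

  ascent-Ascended : ∀ j .(j≤m : j ≤ m) → All (λ x → Ascended j (toℕ x)) (ascent j j≤m)
  ascent-Ascended zero    _     =
    subst (Ascended 0) (sym (toℕ-vertex k ≤-refl)) pendant-vertex ∷ []
  ascent-Ascended (suc j) j+1≤m =
    subst (Ascended (suc j)) (sym (toℕ-vertex (suc j) (≤m⇒≤k j+1≤m)))
          (cycle-vertex (s≤s z≤n) ≤-refl)
    ∷ All.map Ascended-suc (ascent-Ascended j (<⇒≤ j+1≤m))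

  ascent-IsLSeqRev : ∀ j (j≤m : j ≤ m) → IsLSeqRev G (ascent j j≤m)
  ascent-IsLSeqRev zero    _     = IsLSeqRev-∷ G u (inj₁ refl) [] [] ([] , tt)
  ascent-IsLSeqRev (suc j) j+1≤m =
    IsLSeqRev-∷ G w (inj₂ (cycle-edge (suc j) (≤m⇒≤k j+1≤m) (<⇒≤ j+2<k) j+2<k))
      w-unreached v-new (ascent-IsLSeqRev j (<⇒≤ j+1≤m))
    where
    j+3<k : suc (suc (suc j)) < k
    j+3<k = s≤s (s≤s (s≤s j+1≤m))
    j+2<k : suc (suc j) < k
    j+2<k = <⇒≤ j+3<k
    w : Fin (suc k)
    w = vertex (suc (suc j)) (<⇒≤ j+2<k)
    earlier-Ascended : All (λ x → Ascended j (toℕ x)) (ascent j (<⇒≤ j+1≤m))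
    earlier-Ascended = ascent-Ascended j (<⇒≤ j+1≤m)
    v-new : All (vertex (suc j) (≤m⇒≤k j+1≤m) ≢_) (ascent j (<⇒≤ j+1≤m))
    v-new = All-≢-of-¬
      (λ asc → Ascended-avoids asc ≤-refl (<⇒≤ j+2<k) (toℕ-vertex (suc j) (≤m⇒≤k j+1≤m)))
      earlier-Ascended
    w-unreached : All (λ x → ¬ G x w) (ascent j (<⇒≤ j+1≤m))
    w-unreached = All.map
      (λ asc x~w → [ Ascended-avoids asc ≤-refl (<⇒≤ j+2<k) ∘ suc-injective
                   , Ascended-avoids asc (m<n+m j (s≤s z≤n)) j+3<k
                   ]
                   (inner-neighbours (toℕ-vertex (suc (suc j)) (<⇒≤ j+2<k)) (s≤s z≤n) j+3<k x~w))
      earlier-Ascended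

  m+1<k : suc m < k
  m+1<k = s≤s (s≤s (n≤1+n m))

  m+2≤k : suc (suc m) ≤ k
  m+2≤k = n≤1+n (suc (suc m))

  hub penultimate last : Fin (suc k)
  hub        = vertex 0 z≤n
  penultimate = vertex (suc m) (<⇒≤ m+1<k)
  last        = vertex (suc (suc m)) m+2≤k

  lSequence : List (Fin (suc k))
  lSequence = hub ∷ penultimate ∷ last ∷ ascent m ≤-refl

  lSequence-length : length lSequence ≡ suc k
  lSequence-length = cong (suc ∘ suc ∘ suc) (ascent-length m ≤-refl)

  OutsideNbhdOfLast : Fin (suc k) → Set
  OutsideNbhdOfLast x = 0 < toℕ x × toℕ x ≢ suc m

  OutsideNbhdOfLast⇒¬G-last : ∀ {x} → OutsideNbhdOfLast x → ¬ G x last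
  OutsideNbhdOfLast⇒¬G-last (0<x , x≢m+1) x~last =
    [ x≢m+1 ∘ suc-injective , n>0⇒n≢0 0<x ]
      (last-neighbours (toℕ-vertex (suc (suc m)) m+2≤k) (s≤s z≤n) refl x~last)

  lSequence-IsLSeqRev : IsLSeqRev G lSequence
  lSequence-IsLSeqRev =
    IsLSeqRev-∷ G u (inj₂ pendant-edge) (All.map u-unreached positive) hub-new
      (IsLSeqRev-∷ G last (inj₂ (cycle-edge (suc m) (<⇒≤ m+1<k) m+2≤k ≤-refl))
         (All.map OutsideNbhdOfLast⇒¬G-last outside) penultimate-new
        (IsLSeqRev-∷ G last (inj₁ refl)
           (All.map (OutsideNbhdOfLast⇒¬G-last ∘ Ascended⇒OutsideNbhdOfLast) ascended) last-new
          (ascent-IsLSeqRev m ≤-refl)))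
    where
    ascended : All (λ x → Ascended m (toℕ x)) (ascent m ≤-refl)
    ascended = ascent-Ascended m ≤-refl
    last-new : All (last ≢_) (ascent m ≤-refl)
    last-new = All-≢-of-¬
      (λ asc → Ascended-avoids asc (m<n+m m (s≤s z≤n)) ≤-refl (toℕ-vertex (suc (suc m)) m+2≤k))
      ascended
    Ascended⇒OutsideNbhdOfLast : ∀ {x} → Ascended m (toℕ x) → OutsideNbhdOfLast x
    Ascended⇒OutsideNbhdOfLast asc = Ascended-positive asc , Ascended-avoids asc ≤-refl m+1<k
    outside : All OutsideNbhdOfLast (last ∷ ascent m ≤-refl)
    outside =
      ( subst (0 <_) (sym (toℕ-vertex (suc (suc m)) m+2≤k)) (s≤s z≤n)
      , λ last≡m+1 → 1+n≢n (trans (sym (toℕ-vertex (suc (suc m)) m+2≤k)) last≡m+1))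
      ∷ All.map Ascended⇒OutsideNbhdOfLast ascended
    penultimate-new : All (penultimate ≢_) (last ∷ ascent m ≤-refl)
    penultimate-new = All-≢-of-¬ (λ (_ , ≢m+1) → ≢m+1 (toℕ-vertex (suc m) (<⇒≤ m+1<k))) outside
    positive : All (λ x → 0 < toℕ x) (penultimate ∷ last ∷ ascent m ≤-refl)
    positive = subst (0 <_) (sym (toℕ-vertex (suc m) (<⇒≤ m+1<k))) (s≤s z≤n) ∷ All.map proj₁ outside
    hub-new : All (hub ≢_) (penultimate ∷ last ∷ ascent m ≤-refl)
    hub-new = All-≢-of-¬ (λ 0<hub → n>0⇒n≢0 0<hub (toℕ-vertex 0 z≤n)) positive
    u-unreached : ∀ {x} → 0 < toℕ x → ¬ G x u
    u-unreached 0<x x~u = n>0⇒n≢0 0<x (pendant-neighbour (toℕ-vertex k ≤-refl) (s≤s z≤n) x~u)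

theorem3p6 : (k : ℕ) → 3 ≤ k →
    LGrundyDominationNumberIs (CyclePendantAdj k) (suc k)
theorem3p6 (suc (suc (suc m))) (s≤s (s≤s (s≤s _))) =
  (lSequence , lSequence-IsLSeqRev , lSequence-length) , λ _ (vs! , _) → Unique⇒length≤ vs!
  where open CyclePendantLSeq m
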